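{- Let $H=K_{k_1}\Box\cdots\Box K_{k_n}$ and let $G$ be an isometric daisy graph of $H$ with respect to $0^n$, where $H$ is the smallest possible. For every $j\in\{1,\dots,n\}$ and every $i\in\{0,\dots,k_j-1\}$, the subgraph $\langle W_i^j\rangle$ of $G$, identified with its image under deleting the $j$-th coordinate, is a daisy graph of $H'=K_{k_1}\Box\cdots\Box K_{k_{j-1}}\Box K_{k_{j+1}}\Box\cdots\Box K_{k_n}$ with respect to $0^{n-1}$.
   Context: $V(H)=\prod_{i=1}^n\{0,\dots,k_i-1\}$, vertices adjacent iff they differ in exactly one coordinate. For a Hamming graph $K$ with all-zero vertex $0$ and $X\subseteq V(K)$, the daisy graph $K_0(X)$ is the subgraph of $K$ induced by $\bigcup_{v\in X}I_K(0,v)$ ($I_K(a,b)$: vertices on shortest $a,b$-paths); isometric means distance-preserving. "$H$ is the smallest possible" means $G$ is not such a daisy graph of a Hamming graph with fewer or smaller factors. $W_i^j=\{u_1\dots u_n\in V(G): u_j=i\}$. -}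

module Defs where

open import Data.Nat using (ℕ; zero; suc; _+_; _≤_; _<_)
open import Data.Nat.Properties using (_≟_)
open import Data.Fin using (Fin; punchIn)
import Data.Fin as F
open import Data.Product using (Σ; ∃; _×_)
open import Relation.Nullary using (yes; no)
open import Relation.Binary.PropositionalEquality using (_≡_)
open import Function.Bundles using (_⇔_)

-- A vertex of the Hamming graph K_{k_1} □ ... □ K_{k_n} is a word u_1 … u_n
-- with 0 ≤ u_l < k_l.  We represent words as functions Fin n → ℕ and
-- membership in V(H) by the bound predicate InH.
Word : ℕ → Set
Word n = Fin n → ℕ

InH : ∀ {n} → (Fin n → ℕ) → Word n → Set
InH k u = ∀ l → u l < k l

zeroW : ∀ {n} → Word n
zeroW _ = 0

-- Hamming distance: number of coordinates in which u and v differ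
-- (= the graph distance in a Hamming graph).
ham : ∀ {n} → Word n → Word n → ℕ
ham {zero}  u v = 0
ham {suc n} u v with u F.zero ≟ v F.zero
... | yes _ = ham (λ l → u (F.suc l)) (λ l → v (F.suc l))
... | no  _ = suc (ham (λ l → u (F.suc l)) (λ l → v (F.suc l)))

Adj : ∀ {n} → Word n → Word n → Set
Adj u v = ham u v ≡ 1

Interval : ∀ {n} → (Fin n → ℕ) → Word n → Word n → Word n → Set
Interval k a b u = InH k u × (ham a u + ham u b ≡ ham a b)

Daisy : ∀ {n} → (Fin n → ℕ) → (Word n → Set) → Word n → Set
Daisy k X u = ∃ λ v → X v × Interval k zeroW v u

IsDaisyOf : ∀ {n} → (Fin n → ℕ) → (Word n → Set) → Set₁
IsDaisyOf {n} k S =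
  Σ (Word n → Set) λ X → (∀ v → X v → InH k v) × (∀ u → S u ⇔ Daisy k X u)

data Walk {n} (S : Word n → Set) : Word n → Word n → ℕ → Set where
  here : ∀ {u} → S u → Walk S u u 0
  step : ∀ {u w v m} → S u → Adj u w → Walk S w v m → Walk S u v (suc m)

-- ⟨S⟩ is isometric in the Hamming graph: d_⟨S⟩(u,v) = d_K(u,v), expressed
-- as: for every m, d_⟨S⟩(u,v) ≤ m iff d_K(u,v) ≤ m.
Isometric : ∀ {n} → (Word n → Set) → Set
Isometric S = ∀ u v → S u → S v → ∀ m →
  ((∃ λ m' → m' ≤ m × Walk S u v m') ⇔ ham u v ≤ m)

-- H is the smallest possible Hamming graph for G: no factor K_1 can be
-- dropped, and every value i of every coordinate j is used by G.
Minimal : ∀ {n} → (Fin n → ℕ) → (Word n → Set) → Set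
Minimal {n} k S = (∀ j → 2 ≤ k j) × (∀ j i → i < k j → ∃ λ u → S u × u j ≡ i)

W : ∀ {n} → (Word n → Set) → Fin n → ℕ → Word n → Set
W S j i u = S u × u j ≡ i

Proj : ∀ {m} → (Word (suc m) → Set) → Fin (suc m) → ℕ → Word m → Set
Proj S j i w = ∃ λ u → W S j i u × (∀ l → u (punchIn j l) ≡ w l)

{-# OPTIONS --safe #-}
-- A daisy graph with respect to 0 is the same as a vertex set closed under the
-- intervals I(0,v) of its members, and in a Hamming graph u ∈ I(a,b) iff every
-- coordinate of u agrees with a or with b.  If u ∈ W_i^j, w is u with coordinate j
-- deleted and w' ∈ I(0,w), then re-inserting i at position j into w' gives a vertex
-- of I(0,u) ⊆ G lying in W_i^j; so the image of W_i^j is interval-closed.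
module Submission where

open import Defs
open import Data.Nat using (ℕ; zero; suc; _<_; _≤_; _+_; z≤n; s≤s)
open import Data.Nat.Properties
open import Algebra.Properties.CommutativeSemigroup +-commutativeSemigroup using (interchange)
open import Data.Fin using (Fin; punchIn; punchOut)
import Data.Fin as F
import Data.Fin.Properties as FinP
open import Data.Vec.Functional using (tail; insertAt)
open import Data.Vec.Functional.Properties using (insertAt-lookup; insertAt-punchIn)
open import Data.Product using (_×_; _,_; proj₁; proj₂)
open import Data.Sum using (_⊎_; inj₁; inj₂) renaming (map to ⊎-map)
open import Data.Empty using (⊥-elim)
open import Relation.Nullary using (yes; no)
open import Relation.Binary.PropositionalEquality
open import Function using (_∘_)
open import Function.Bundles using (mk⇔; Equivalence)

+-≤-tight : ∀ {x x' y y'} → x ≤ x' → y ≤ y' → x' + y' ≡ x + y → x ≡ x' × y ≡ y'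
+-≤-tight {x} {x'} {y} {y'} x≤x' y≤y' eq = x≡x' , ≤-antisym y≤y' y'≤y
  where
  x'≤x : x' ≤ x
  x'≤x = +-cancelʳ-≤ y x' x (≤-trans (+-monoʳ-≤ x' y≤y') (≤-reflexive eq))
  x≡x' : x ≡ x'
  x≡x' = ≤-antisym x≤x' x'≤x
  y'≤y : y' ≤ y
  y'≤y = +-cancelˡ-≤ x y' y (≤-trans (+-monoˡ-≤ y' x≤x') (≤-reflexive eq))

δ : ℕ → ℕ → ℕ
δ x y with x ≟ y
... | yes _ = 0
... | no  _ = 1

δ-self : ∀ x → δ x x ≡ 0
δ-self x with x ≟ x
... | yes _ = refl
... | no x≢x = ⊥-elim (x≢x refl)

δ-triangle : ∀ x y z → δ x z ≤ δ x y + δ y z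
δ-triangle x y z with x ≟ y | y ≟ z | x ≟ z
... | _        | _        | yes _ = z≤n
... | no _     | _        | no _  = s≤s z≤n
... | yes _    | no _     | no _  = s≤s z≤n
... | yes refl | yes refl | no x≢x = ⊥-elim (x≢x refl)

δ-geodesic⇒≡ : ∀ x y z → δ x y + δ y z ≡ δ x z → y ≡ x ⊎ y ≡ z
δ-geodesic⇒≡ x y z eq with x ≟ y | y ≟ z | x ≟ z
δ-geodesic⇒≡ x y z _  | yes x≡y | _       | _     = inj₁ (sym x≡y)
δ-geodesic⇒≡ x y z _  | no _    | yes y≡z | _     = inj₂ y≡z
δ-geodesic⇒≡ x y z () | no _    | no _    | yes _
δ-geodesic⇒≡ x y z () | no _    | no _    | no _

≡⇒δ-geodesic : ∀ x y z → y ≡ x ⊎ y ≡ z → δ x y + δ y z ≡ δ x z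
≡⇒δ-geodesic x .x z (inj₁ refl) = cong (_+ δ x z) (δ-self x)
≡⇒δ-geodesic x .z z (inj₂ refl) = trans (cong (δ x z +_) (δ-self z)) (+-identityʳ _)

ham-suc : ∀ {n} (u v : Word (suc n)) → ham u v ≡ δ (u F.zero) (v F.zero) + ham (tail u) (tail v)
ham-suc u v with u F.zero ≟ v F.zero
... | yes _ = refl
... | no  _ = refl

ham-self : ∀ {n} (u : Word n) → ham u u ≡ 0
ham-self {zero}  u = refl
ham-self {suc n} u = trans (ham-suc u u) (cong₂ _+_ (δ-self (u F.zero)) (ham-self (tail u)))

ham-path-suc : ∀ {n} (a u b : Word (suc n)) → ham a u + ham u b ≡
  (δ (a F.zero) (u F.zero) + δ (u F.zero) (b F.zero)) + (ham (tail a) (tail u) + ham (tail u) (tail b))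
ham-path-suc a u b = trans (cong₂ _+_ (ham-suc a u) (ham-suc u b))
  (interchange (δ (a F.zero) (u F.zero)) (ham (tail a) (tail u)) (δ (u F.zero) (b F.zero)) (ham (tail u) (tail b)))

ham-triangle : ∀ {n} (a u b : Word n) → ham a b ≤ ham a u + ham u b
ham-triangle {zero}  a u b = z≤n
ham-triangle {suc n} a u b = begin
  ham a b                                        ≡⟨ ham-suc a b ⟩
  δ (a F.zero) (b F.zero) + ham (tail a) (tail b) ≤⟨ +-mono-≤ (δ-triangle _ _ _) (ham-triangle (tail a) (tail u) (tail b)) ⟩
  _                                              ≡⟨ ham-path-suc a u b ⟨
  ham a u + ham u b                              ∎
  where open ≤-Reasoning

Between : ∀ {n} → Word n → Word n → Word n → Set
Between a b u = ∀ l → u l ≡ a l ⊎ u l ≡ b l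

ham-geodesic⇒Between : ∀ {n} (a u b : Word n) → ham a u + ham u b ≡ ham a b → Between a b u
ham-geodesic⇒Between {suc n} a u b eq l
  with +-≤-tight (δ-triangle _ _ _) (ham-triangle (tail a) (tail u) (tail b))
                 (trans (sym (ham-path-suc a u b)) (trans eq (ham-suc a b)))
... | head-tight , tail-tight with l
...   | F.zero   = δ-geodesic⇒≡ (a F.zero) (u F.zero) (b F.zero) (sym head-tight)
...   | F.suc l' = ham-geodesic⇒Between (tail a) (tail u) (tail b) (sym tail-tight) l'

Between⇒ham-geodesic : ∀ {n} (a u b : Word n) → Between a b u → ham a u + ham u b ≡ ham a b
Between⇒ham-geodesic {zero}  a u b _ = refl
Between⇒ham-geodesic {suc n} a u b between = begin
  ham a u + ham u b ≡⟨ ham-path-suc a u b ⟩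
  _                 ≡⟨ cong₂ _+_ (≡⇒δ-geodesic _ _ _ (between F.zero))
                                 (Between⇒ham-geodesic (tail a) (tail u) (tail b) (between ∘ F.suc)) ⟩
  _                 ≡⟨ ham-suc a b ⟨
  ham a b           ∎
  where open ≡-Reasoning

Between-trans : ∀ {n} {a b v u : Word n} → Between a b v → Between a v u → Between a b u
Between-trans v∈ab u∈av l with u∈av l | v∈ab l
... | inj₁ uₗ≡aₗ | _           = inj₁ uₗ≡aₗ
... | inj₂ uₗ≡vₗ | inj₁ vₗ≡aₗ = inj₁ (trans uₗ≡vₗ vₗ≡aₗ)
... | inj₂ uₗ≡vₗ | inj₂ vₗ≡bₗ = inj₂ (trans uₗ≡vₗ vₗ≡bₗ)

Between-zero-InH : ∀ {n} {k : Fin n → ℕ} {v u : Word n} → InH k v → Between zeroW v u → InH k u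
Between-zero-InH {k = k} v∈H u∈0v l with u∈0v l
... | inj₁ uₗ≡0 = subst (_< k l) (sym uₗ≡0) (≤-<-trans z≤n (v∈H l))
... | inj₂ uₗ≡vₗ = subst (_< k l) (sym uₗ≡vₗ) (v∈H l)

Interval⇒Between : ∀ {n} {k : Fin n → ℕ} {a b u : Word n} → Interval k a b u → Between a b u
Interval⇒Between {a = a} {b} {u} (_ , geodesic) = ham-geodesic⇒Between a u b geodesic

Between⇒Interval : ∀ {n} {k : Fin n → ℕ} {a b u : Word n} → InH k u → Between a b u → Interval k a b u
Between⇒Interval {a = a} {b} {u} u∈H between = u∈H , Between⇒ham-geodesic a u b between

DownClosed : ∀ {n} → (Fin n → ℕ) → (Word n → Set) → Set
DownClosed k S = ∀ {v u} → S v → Interval k zeroW v u → S u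

IsDaisyOf⇒InH : ∀ {n} {k : Fin n → ℕ} {S : Word n → Set} → IsDaisyOf k S → ∀ u → S u → InH k u
IsDaisyOf⇒InH (_ , _ , S⇔) u u∈S = proj₁ (proj₂ (proj₂ (Equivalence.to (S⇔ u) u∈S)))

IsDaisyOf⇒DownClosed : ∀ {n} {k : Fin n → ℕ} {S : Word n → Set} → IsDaisyOf k S → DownClosed k S
IsDaisyOf⇒DownClosed (_ , _ , S⇔) {v} {u} v∈S (u∈H , u∈0v) with Equivalence.to (S⇔ v) v∈S
... | x , x∈X , v∈0x = Equivalence.from (S⇔ u) (x , x∈X , Between⇒Interval u∈H
  (Between-trans (Interval⇒Between v∈0x) (ham-geodesic⇒Between zeroW u v u∈0v)))

DownClosed⇒IsDaisyOf : ∀ {n} {k : Fin n → ℕ} {S : Word n → Set} →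
  (∀ u → S u → InH k u) → DownClosed k S → IsDaisyOf k S
DownClosed⇒IsDaisyOf {S = S} S⊆H closed = S , S⊆H , λ u → mk⇔ (λ u∈S → u , u∈S , u∈0u u u∈S) to-S
  where
  u∈0u : ∀ u → S u → Interval _ zeroW u u
  u∈0u u u∈S = S⊆H u u∈S , trans (cong (ham zeroW u +_) (ham-self u)) (+-identityʳ _)
  to-S : ∀ {u} → Daisy _ S u → S u
  to-S (v , v∈S , u∈0v) = closed v∈S u∈0v

punchIn-elim : ∀ {n} {P : Fin (suc n) → Set} (j : Fin (suc n)) → P j → (∀ l → P (punchIn j l)) → ∀ l → P l
punchIn-elim {P = P} j Pj P-punchIn l with j FinP.≟ l
... | yes refl = Pj
... | no j≢l   = subst P (FinP.punchIn-punchOut j≢l) (P-punchIn (punchOut j≢l))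

module _ {m} {k : Fin (suc m) → ℕ} {G : Word (suc m) → Set} (j : Fin (suc m)) (i : ℕ) where

  Proj-InH : (∀ u → G u → InH k u) → ∀ w → Proj G j i w → InH (λ l → k (punchIn j l)) w
  Proj-InH G⊆H w (u , (u∈G , _) , u∘punchIn≡w) l = subst (_< _) (u∘punchIn≡w l) (G⊆H u u∈G (punchIn j l))

  Proj-DownClosed : (∀ u → G u → InH k u) → DownClosed k G → DownClosed (λ l → k (punchIn j l)) (Proj G j i)
  Proj-DownClosed G⊆H closed {w} {w'} (u , (u∈G , uⱼ≡i) , u∘punchIn≡w) w'∈0w =
    u' , (closed u∈G (Between⇒Interval (Between-zero-InH (G⊆H u u∈G) u'∈0u) u'∈0u) , insertAt-lookup w' j i) ,
    insertAt-punchIn w' j i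
    where
    u' : Word (suc m)
    u' = insertAt w' j i
    u'∈0u : Between zeroW u u'
    u'∈0u = punchIn-elim {P = λ l → u' l ≡ 0 ⊎ u' l ≡ u l} j (inj₂ (trans (insertAt-lookup w' j i) (sym uⱼ≡i))) λ l →
      ⊎-map (trans (insertAt-punchIn w' j i l))
            (λ w'ₗ≡wₗ → trans (insertAt-punchIn w' j i l) (trans w'ₗ≡wₗ (sym (u∘punchIn≡w l))))
            (Interval⇒Between w'∈0w l)

lemma3p6 : (m : ℕ) (k : Fin (suc m) → ℕ) (G : Word (suc m) → Set) →
    IsDaisyOf k G → Isometric G → Minimal k G →
    (j : Fin (suc m)) (i : ℕ) → i < k j →
    IsDaisyOf (λ l → k (punchIn j l)) (Proj G j i)
lemma3p6 m k G G-daisy _ _ j i _ =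
  DownClosed⇒IsDaisyOf (Proj-InH j i G⊆H) (Proj-DownClosed j i G⊆H (IsDaisyOf⇒DownClosed G-daisy))
  where
  G⊆H : ∀ u → G u → InH k u
  G⊆H = IsDaisyOf⇒InH G-daisy
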